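{- Let $C$ be the hypersequent $\Rightarrow \neg\Box\neg\Box(p\land q)\lor\Box(\neg\Box p\lor\Box\neg\Box q)$, with $p,q$ distinct atoms. There is a PS4 model which is a countermodel to $C$.
   Context: A PS4 frame is $\langle W,R,S\rangle$, $W\ne\emptyset$, $R,S\subseteq W^2$, with $S$ and $R$ reflexive, (Pseudo-Transitivity) $xRy,yRz\Rightarrow\exists w(xRw\wedge zSw)$, (Forth) $xRy,xSz\Rightarrow\exists w(zRw\wedge ySw)$, (Back) $xSz,zRw\Rightarrow\exists y(xRy\wedge ySw)$. A PS4 model adds $v:$ formulas$\times W\to\{1,*,0\}$ obeying strong Kleene clauses ($\neg$ swaps $1,0$ and fixes $*$; $\phi\land\psi$ is $1$ iff both $1$, $0$ iff some $0$; $\phi\lor\psi$ is $1$ iff some $1$, $0$ iff both $0$; $\Box\phi$ is $1$ at $x$ iff $\phi$ is $1$ at all $R$-successors of $x$, $0$ iff $\phi$ is $0$ at some $R$-successor; otherwise $*$), and such that if $xSy$ then every atom with value in $\{1,0\}$ at $x$ has the same value at $y$. A model is a countermodel to the hypersequent $\Rightarrow\phi$ iff $v(\phi,w)=0$ for some point $w$. -}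

module Defs where

open import Data.Nat using (ℕ)
open import Data.Product using (Σ; ∃; _×_; _,_)
open import Relation.Binary.PropositionalEquality using (_≡_; _≢_)
open import Function.Bundles using (_⇔_)

-- Three truth values of strong Kleene logic: 1, *, 0
data TV : Set where
  t1 ts t0 : TV

data Form : Set where
  atom : ℕ → Form
  ¬'_  : Form → Form
  _∧'_ : Form → Form → Form
  _∨'_ : Form → Form → Form
  □_   : Form → Form

infixr 6 _∧'_
infixr 5 _∨'_
infix 7 ¬'_ □_

negK : TV → TV
negK t1 = t0
negK ts = ts
negK t0 = t1

andK : TV → TV → TV
andK t0 _  = t0
andK _  t0 = t0
andK t1 t1 = t1
andK _  _  = ts

orK : TV → TV → TV
orK t1 _  = t1
orK _  t1 = t1
orK t0 t0 = t0
orK _  _  = ts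

record PS4Frame : Set₁ where
  field
    W     : Set
    point : W                         -- W ≠ ∅
    R S   : W → W → Set
    R-refl : ∀ x → R x x
    S-refl : ∀ x → S x x
    pseudoTrans : ∀ {x y z} → R x y → R y z → ∃ λ w → R x w × S z w
    forth : ∀ {x y z} → R x y → S x z → ∃ λ w → R z w × S y w
    back  : ∀ {x z w} → S x z → R z w → ∃ λ y → R x y × S y w

record PS4Model : Set₁ where
  field
    frame : PS4Frame
  open PS4Frame frame public
  field
    v : Form → W → TV
    v-neg : ∀ φ x → v (¬' φ) x ≡ negK (v φ x)
    v-and : ∀ φ ψ x → v (φ ∧' ψ) x ≡ andK (v φ x) (v ψ x)
    v-or  : ∀ φ ψ x → v (φ ∨' ψ) x ≡ orK (v φ x) (v ψ x)
    -- □φ is 1 iff φ is 1 at all R-successors; 0 iff φ is 0 at some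
    -- R-successor; otherwise * (the remaining value of TV)
    v-box1 : ∀ φ x → v (□ φ) x ≡ t1 ⇔ (∀ y → R x y → v φ y ≡ t1)
    v-box0 : ∀ φ x → v (□ φ) x ≡ t0 ⇔ (∃ λ y → R x y × v φ y ≡ t0)
    v-persist : ∀ n x y → S x y → v (atom n) x ≢ ts → v (atom n) y ≡ v (atom n) x

-- M is a countermodel to the hypersequent ⇒ φ
Countermodel : PS4Model → Form → Set
Countermodel M φ = ∃ λ w → v w ≡ t0
  where open PS4Model M renaming (v to v')
        v : W → TV
        v = v' φ

formulaC : Form → Form → Form
formulaC p q = (¬' □ ¬' □ (p ∧' q)) ∨' □ (¬' □ p ∨' □ ¬' □ q)

-- The first disjunct
-- ¬□¬□(p∧q) is 0 at w because every R-successor of w sees a point where p∧q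
-- is 0 (y, where q is 0, or u, where p is 0).  The second disjunct is 0 at w
-- because w R y, p is 1 throughout the R-successors {y, z} of y, and q is 1
-- throughout the R-successors {z, a} of z.  Pseudo-transitivity for y R z R a
-- forces a S z, which persistence allows only because p is * at a.
module Submission where

open import Defs
open import Data.Bool using (Bool; true; false; T)
open import Data.Bool.Properties using (T?)
open import Data.Empty using (⊥-elim)
open import Data.List using (List; []; _∷_; foldr; map; filter)
open import Data.List.Membership.Propositional using (_∈_; find; lose)
open import Data.List.Membership.Propositional.Properties using (∈-filter⁺; ∈-filter⁻)
open import Data.List.Relation.Unary.All as All using (All; []; _∷_; all?)
open import Data.List.Relation.Unary.All.Properties as All using ()
open import Data.List.Relation.Unary.Any as Any using (Any; here; there; any?)
open import Data.List.Relation.Unary.Any.Properties as Any using ()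
open import Data.Nat using (ℕ; _≟_)
open import Data.Product using (Σ; ∃; _×_; _,_; proj₂)
open import Data.Sum using (_⊎_; inj₁; inj₂)
open import Data.Unit using (tt)
open import Function.Bundles using (_⇔_; mk⇔; module Equivalence)
open import Relation.Binary.Definitions using (Decidable; DecidableEquality)
open import Relation.Binary.PropositionalEquality using (_≡_; _≢_; refl; sym; trans)
open import Relation.Nullary using (Dec; yes; no; ¬?)
open import Relation.Nullary.Decidable using (map′; from-yes; _×-dec_; _→-dec_)
import Relation.Unary as U

_≟ᵀ_ : DecidableEquality TV
t1 ≟ᵀ t1 = yes refl
t1 ≟ᵀ ts = no λ ()
t1 ≟ᵀ t0 = no λ ()
ts ≟ᵀ t1 = no λ ()
ts ≟ᵀ ts = yes refl
ts ≟ᵀ t0 = no λ ()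
t0 ≟ᵀ t1 = no λ ()
t0 ≟ᵀ ts = no λ ()
t0 ≟ᵀ t0 = yes refl

andK≡t1 : ∀ a b → andK a b ≡ t1 ⇔ (a ≡ t1 × b ≡ t1)
andK≡t1 a b = mk⇔ (to a b) λ { (refl , refl) → refl }
  where
  to : ∀ a b → andK a b ≡ t1 → a ≡ t1 × b ≡ t1
  to t1 t1 _ = refl , refl
  to t1 ts ()
  to t1 t0 ()
  to ts t1 ()
  to ts ts ()
  to ts t0 ()
  to t0 _  ()

andK≡t0 : ∀ a b → andK a b ≡ t0 ⇔ (a ≡ t0 ⊎ b ≡ t0)
andK≡t0 a b = mk⇔ (to a b) (from a b)
  where
  to : ∀ a b → andK a b ≡ t0 → a ≡ t0 ⊎ b ≡ t0
  to t0 _  _ = inj₁ refl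
  to t1 t0 _ = inj₂ refl
  to ts t0 _ = inj₂ refl
  to t1 t1 ()
  to t1 ts ()
  to ts t1 ()
  to ts ts ()
  from : ∀ a b → a ≡ t0 ⊎ b ≡ t0 → andK a b ≡ t0
  from t0 _  _          = refl
  from t1 t0 _          = refl
  from ts t0 _          = refl
  from t1 t1 (inj₁ ())
  from t1 t1 (inj₂ ())
  from t1 ts (inj₁ ())
  from t1 ts (inj₂ ())
  from ts t1 (inj₁ ())
  from ts t1 (inj₂ ())
  from ts ts (inj₁ ())
  from ts ts (inj₂ ())

orK≡t0 : ∀ {a b} → a ≡ t0 → b ≡ t0 → orK a b ≡ t0
orK≡t0 refl refl = refl

negK≡t0 : ∀ {a} → a ≡ t1 → negK a ≡ t0
negK≡t0 refl = refl

negK≡t1 : ∀ {a} → a ≡ t0 → negK a ≡ t1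
negK≡t1 refl = refl

⋀ : List TV → TV
⋀ = foldr andK t1

⋀≡t1 : ∀ as → ⋀ as ≡ t1 ⇔ All (_≡ t1) as
⋀≡t1 as = mk⇔ (to as) (from as)
  where
  to : ∀ as → ⋀ as ≡ t1 → All (_≡ t1) as
  to []       _ = []
  to (a ∷ as) e = let e₁ , e₂ = Equivalence.to (andK≡t1 a (⋀ as)) e in e₁ ∷ to as e₂
  from : ∀ as → All (_≡ t1) as → ⋀ as ≡ t1
  from []       []       = refl
  from (a ∷ as) (e ∷ es) = Equivalence.from (andK≡t1 a (⋀ as)) (e , from as es)

⋀≡t0 : ∀ as → ⋀ as ≡ t0 ⇔ Any (_≡ t0) as
⋀≡t0 as = mk⇔ (to as) (from as)
  where
  to : ∀ as → ⋀ as ≡ t0 → Any (_≡ t0) as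
  to []       ()
  to (a ∷ as) e with Equivalence.to (andK≡t0 a (⋀ as)) e
  ... | inj₁ e₁ = here e₁
  ... | inj₂ e₂ = there (to as e₂)
  from : ∀ as → Any (_≡ t0) as → ⋀ as ≡ t0
  from (a ∷ as) (here e)  = Equivalence.from (andK≡t0 a (⋀ as)) (inj₁ e)
  from (a ∷ as) (there e) = Equivalence.from (andK≡t0 a (⋀ as)) (inj₂ (from as e))

Persistent : {W : Set} → (W → W → Set) → (W → TV) → Set
Persistent S f = ∀ x y → S x y → f x ≢ ts → f y ≡ f x

module Enumerated {W : Set} (points : List W) (points-complete : ∀ x → x ∈ points) where

  ∀? : {P : W → Set} → U.Decidable P → Dec (∀ x → P x)
  ∀? P? = map′ (λ ps x → All.lookup ps (points-complete x))
               (λ f → All.tabulate λ {x} _ → f x)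
               (all? P? points)

  ∃? : {P : W → Set} → U.Decidable P → Dec (∃ P)
  ∃? P? = map′ (λ ps → let x , _ , px = find ps in x , px)
               (λ (x , px) → lose (points-complete x) px)
               (any? P? points)

  reflexive? : {Q : W → W → Set} → Decidable Q → Dec (∀ x → Q x x)
  reflexive? Q? = ∀? λ x → Q? x x

  module Conditions {R S : W → W → Set} (R? : Decidable R) (S? : Decidable S) where

    PseudoTransitive Forth Back : Set
    PseudoTransitive = ∀ {x y z} → R x y → R y z → ∃ λ w → R x w × S z w
    Forth            = ∀ {x y z} → R x y → S x z → ∃ λ w → R z w × S y w
    Back             = ∀ {x z w} → S x z → R z w → ∃ λ y → R x y × S y w

    pseudoTransitive? : Dec PseudoTransitive
    pseudoTransitive? = map′ (λ h {x y z} → h x y z) (λ h x y z → h) (∀? λ x → ∀? λ y → ∀? λ z →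
      R? x y →-dec R? y z →-dec ∃? λ w → R? x w ×-dec S? z w)

    forth? : Dec Forth
    forth? = map′ (λ h {x y z} → h x y z) (λ h x y z → h) (∀? λ x → ∀? λ y → ∀? λ z →
      R? x y →-dec S? x z →-dec ∃? λ w → R? z w ×-dec S? y w)

    back? : Dec Back
    back? = map′ (λ h {x z w} → h x z w) (λ h x z w → h) (∀? λ x → ∀? λ z → ∀? λ w →
      S? x z →-dec R? z w →-dec ∃? λ y → R? x y ×-dec S? y w)

    persistent? : ∀ f → Dec (Persistent S f)
    persistent? f = ∀? λ x → ∀? λ y → S? x y →-dec ¬? (f x ≟ᵀ ts) →-dec f y ≟ᵀ f x

module FiniteModel (F : PS4Frame) (points : List (PS4Frame.W F))
                   (points-complete : ∀ x → x ∈ points) (R? : Decidable (PS4Frame.R F)) where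

  open PS4Frame F

  successors : W → List W
  successors x = filter (R? x) points

  ∈-successors⁺ : ∀ {x y} → R x y → y ∈ successors x
  ∈-successors⁺ r = ∈-filter⁺ (R? _) (points-complete _) r

  ∈-successors⁻ : ∀ {x y} → y ∈ successors x → R x y
  ∈-successors⁻ {x} y∈ = proj₂ (∈-filter⁻ (R? x) {xs = points} y∈)

  boxK : (W → TV) → W → TV
  boxK f x = ⋀ (map f (successors x))

  boxK≡t1 : ∀ f x → boxK f x ≡ t1 ⇔ (∀ y → R x y → f y ≡ t1)
  boxK≡t1 f x = mk⇔
    (λ e y r → All.lookup (All.map⁻ (Equivalence.to ⋀≡t1′ e)) (∈-successors⁺ r))
    (λ h → Equivalence.from ⋀≡t1′ (All.map⁺ (All.tabulate λ y∈ → h _ (∈-successors⁻ y∈))))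
    where
    ⋀≡t1′ : boxK f x ≡ t1 ⇔ All (_≡ t1) (map f (successors x))
    ⋀≡t1′ = ⋀≡t1 (map f (successors x))

  boxK≡t0 : ∀ f x → boxK f x ≡ t0 ⇔ (∃ λ y → R x y × f y ≡ t0)
  boxK≡t0 f x = mk⇔
    (λ e → let y , y∈ , fy = find (Any.map⁻ (Equivalence.to ⋀≡t0′ e)) in y , ∈-successors⁻ y∈ , fy)
    (λ (y , r , fy) → Equivalence.from ⋀≡t0′ (Any.map⁺ (lose (∈-successors⁺ r) fy)))
    where
    ⋀≡t0′ : boxK f x ≡ t0 ⇔ Any (_≡ t0) (map f (successors x))
    ⋀≡t0′ = ⋀≡t0 (map f (successors x))

  eval : (ℕ → W → TV) → Form → W → TV
  eval val (atom n) x = val n x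
  eval val (¬' φ)   x = negK (eval val φ x)
  eval val (φ ∧' ψ) x = andK (eval val φ x) (eval val ψ x)
  eval val (φ ∨' ψ) x = orK (eval val φ x) (eval val ψ x)
  eval val (□ φ)    x = boxK (eval val φ) x

  model : (val : ℕ → W → TV) → (∀ n → Persistent S (val n)) → PS4Model
  model val persistent = record
    { frame     = F
    ; v         = eval val
    ; v-neg     = λ _ _ → refl
    ; v-and     = λ _ _ _ → refl
    ; v-or      = λ _ _ _ → refl
    ; v-box1    = λ φ → boxK≡t1 (eval val φ)
    ; v-box0    = λ φ → boxK≡t0 (eval val φ)
    ; v-persist = persistent
    }

module _ (M : PS4Model) where

  open PS4Model M

  formulaC≡t0 : ∀ {φ ψ x} →
    (∀ y → R x y → ∃ λ z → R y z × v (φ ∧' ψ) z ≡ t0) →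
    (∃ λ y → R x y × (∀ z → R y z → v φ z ≡ t1) ×
             (∃ λ z → R y z × ∀ u → R z u → v ψ u ≡ t1)) →
    v (formulaC φ ψ) x ≡ t0
  formulaC≡t0 {φ} {ψ} {x} every-successor-refutes-φ∧ψ (y , xRy , φ-after-y , z , yRz , ψ-after-z) =
    trans (v-or _ _ x) (orK≡t0 left≡t0 right≡t0)
    where
    □¬□φ∧ψ≡t1 : v (□ ¬' □ (φ ∧' ψ)) x ≡ t1
    □¬□φ∧ψ≡t1 = Equivalence.from (v-box1 _ x) λ y′ r →
      trans (v-neg _ y′) (negK≡t1 (Equivalence.from (v-box0 _ y′) (every-successor-refutes-φ∧ψ y′ r)))

    left≡t0 : v (¬' □ ¬' □ (φ ∧' ψ)) x ≡ t0
    left≡t0 = trans (v-neg _ x) (negK≡t0 □¬□φ∧ψ≡t1)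

    □¬□ψ≡t0 : v (□ ¬' □ ψ) y ≡ t0
    □¬□ψ≡t0 = Equivalence.from (v-box0 _ y)
      (z , yRz , trans (v-neg _ z) (negK≡t0 (Equivalence.from (v-box1 _ z) ψ-after-z)))

    disjunct≡t0 : v (¬' □ φ ∨' □ ¬' □ ψ) y ≡ t0
    disjunct≡t0 = trans (v-or _ _ y)
      (orK≡t0 (trans (v-neg _ y) (negK≡t0 (Equivalence.from (v-box1 _ y) φ-after-y))) □¬□ψ≡t0)

    right≡t0 : v (□ (¬' □ φ ∨' □ ¬' □ ψ)) x ≡ t0
    right≡t0 = Equivalence.from (v-box0 _ x) (y , xRy , disjunct≡t0)

data Point : Set where
  w y z a c u : Point

points : List Point
points = w ∷ y ∷ z ∷ a ∷ c ∷ u ∷ []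

points-complete : ∀ x → x ∈ points
points-complete w = here refl
points-complete y = there (here refl)
points-complete z = there (there (here refl))
points-complete a = there (there (there (here refl)))
points-complete c = there (there (there (there (here refl))))
points-complete u = there (there (there (there (there (here refl)))))

Rᵇ Sᵇ : Point → Point → Bool
Rᵇ w w = true
Rᵇ w y = true
Rᵇ w c = true
Rᵇ w u = true
Rᵇ y y = true
Rᵇ y z = true
Rᵇ z z = true
Rᵇ z a = true
Rᵇ a a = true
Rᵇ c c = true
Rᵇ c u = true
Rᵇ u u = true
Rᵇ _ _ = false

Sᵇ w w = true
Sᵇ y y = true
Sᵇ z z = true
Sᵇ z c = true
Sᵇ a a = true
Sᵇ a z = true
Sᵇ a u = true
Sᵇ c c = true
Sᵇ u u = true
Sᵇ _ _ = false

_R_ _S_ : Point → Point → Set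
x R x′ = T (Rᵇ x x′)
x S x′ = T (Sᵇ x x′)

_R?_ : Decidable _R_
x R? x′ = T? (Rᵇ x x′)

_S?_ : Decidable _S_
x S? x′ = T? (Sᵇ x x′)

pᵛ qᵛ : Point → TV
pᵛ a = ts
pᵛ u = t0
pᵛ _ = t1

qᵛ y = t0
qᵛ _ = t1

open Enumerated points points-complete
open Conditions _R?_ _S?_

frame : PS4Frame
frame = record
  { W = Point ; point = w ; R = _R_ ; S = _S_
  ; R-refl      = from-yes (reflexive? _R?_)
  ; S-refl      = from-yes (reflexive? _S?_)
  ; pseudoTrans = from-yes pseudoTransitive?
  ; forth       = from-yes forth?
  ; back        = from-yes back?
  }

every-successor-of-w-refutes-p∧q : ∀ x → w R x → ∃ λ x′ → x R x′ × andK (pᵛ x′) (qᵛ x′) ≡ t0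
every-successor-of-w-refutes-p∧q w _ = y , tt , refl
every-successor-of-w-refutes-p∧q y _ = y , tt , refl
every-successor-of-w-refutes-p∧q c _ = u , tt , refl
every-successor-of-w-refutes-p∧q u _ = u , tt , refl

p-holds-after-y : ∀ x → y R x → pᵛ x ≡ t1
p-holds-after-y y _ = refl
p-holds-after-y z _ = refl

q-holds-after-z : ∀ x → z R x → qᵛ x ≡ t1
q-holds-after-z z _ = refl
q-holds-after-z a _ = refl

atomValuation : ℕ → ℕ → ℕ → Point → TV
atomValuation p q n with n ≟ p | n ≟ q
... | yes _ | _     = pᵛ
... | no _  | yes _ = qᵛ
... | no _  | no _  = λ _ → ts

atomValuation-p : ∀ p q → atomValuation p q p ≡ pᵛ
atomValuation-p p q with p ≟ p
... | yes _ = refl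
... | no p≢p = ⊥-elim (p≢p refl)

atomValuation-q : ∀ {p q} → p ≢ q → atomValuation p q q ≡ qᵛ
atomValuation-q {p} {q} p≢q with q ≟ p | q ≟ q
... | yes q≡p | _     = ⊥-elim (p≢q (sym q≡p))
... | no _    | yes _ = refl
... | no _    | no q≢q = ⊥-elim (q≢q refl)

atomValuation-persistent : ∀ p q n → Persistent _S_ (atomValuation p q n)
atomValuation-persistent p q n with n ≟ p | n ≟ q
... | yes _ | _     = from-yes (persistent? pᵛ)
... | no _  | yes _ = from-yes (persistent? qᵛ)
... | no _  | no _  = λ _ _ _ x≢ts → ⊥-elim (x≢ts refl)

open FiniteModel frame points points-complete _R?_

mainTheorem13 : (p q : ℕ) → p ≢ q →
    Σ PS4Model (λ M → Countermodel M (formulaC (atom p) (atom q)))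
mainTheorem13 p q p≢q = M , w , formulaC≡t0 M {atom p} {atom q}
  (λ x r → let x′ , r′ , e = every-successor-of-w-refutes-p∧q x r in x′ , r′ , ⟦p∧q⟧ x′ e)
  (y , tt , (λ x r → ⟦p⟧ x (p-holds-after-y x r)) , z , tt , (λ x r → ⟦q⟧ x (q-holds-after-z x r)))
  where
  val : ℕ → Point → TV
  val = atomValuation p q
  M : PS4Model
  M = model val (atomValuation-persistent p q)
  ⟦p⟧ : ∀ x {b} → pᵛ x ≡ b → val p x ≡ b
  ⟦p⟧ x rewrite atomValuation-p p q = λ e → e
  ⟦q⟧ : ∀ x {b} → qᵛ x ≡ b → val q x ≡ b
  ⟦q⟧ x rewrite atomValuation-q p≢q = λ e → e
  ⟦p∧q⟧ : ∀ x → andK (pᵛ x) (qᵛ x) ≡ t0 → andK (val p x) (val q x) ≡ t0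
  ⟦p∧q⟧ x rewrite atomValuation-p p q | atomValuation-q p≢q = λ e → e
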